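{- If $G$ is a connected graph of girth at least $6$ and minimum degree at least $3$, then $\alpha_b(G)<2\alpha(G)$.
   Context: All graphs are finite, simple and undirected. $\alpha(G)$ is the independence number of $G$ (maximum size of a set of pairwise nonadjacent vertices). For a connected graph $G$, an independent broadcast on $G$ is a function $f:V(G)\to\{0,1,2,\dots\}$ such that (B1) $f(x)\le \mathrm{ecc}_G(x)$ for every vertex $x$, where $\mathrm{ecc}_G(x)$ is the eccentricity of $x$ in $G$, and (B2) $\mathrm{dist}_G(x,y)>\max\{f(x),f(y)\}$ for every two distinct vertices $x,y$ with $f(x),f(y)>0$. The weight of $f$ is $\sum_{x\in V(G)}f(x)$, and the broadcast independence number $\alpha_b(G)$ is the maximum weight of an independent broadcast on $G$. -}

module Defs where

open import Data.Nat using (ℕ; zero; suc; _+_; _≤_; _<_; _⊔_)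
open import Data.Fin using (Fin)
open import Data.Fin.Subset using (Subset; _∈_; ∣_∣)
open import Data.Bool using (Bool; true; false)
open import Data.List using (List; length; filterᵇ; map; allFin)
open import Data.Nat.ListAction using (sum)
open import Data.Product using (Σ; ∃; ∃-syntax; _×_; _,_)
open import Relation.Binary.PropositionalEquality using (_≡_; _≢_)
open import Function.Definitions using (Injective)

record Graph (n : ℕ) : Set where
  field
    adj     : Fin n → Fin n → Bool
    adj-sym : ∀ x y → adj x y ≡ adj y x
    adj-irr : ∀ x → adj x x ≡ false
open Graph public

module _ {n : ℕ} (G : Graph n) where

  Adj : Fin n → Fin n → Set
  Adj x y = adj G x y ≡ true

  data Walk : Fin n → Fin n → ℕ → Set where
    here : ∀ {x} → Walk x x zero
    step : ∀ {x y z k} → Adj x y → Walk y z k → Walk x z (suc k)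

  Connected : Set
  Connected = ∀ x y → ∃[ k ] Walk x y k

  Dist : Fin n → Fin n → ℕ → Set
  Dist x y d = Walk x y d × (∀ k → Walk x y k → d ≤ k)

  Ecc : Fin n → ℕ → Set
  Ecc x e = (∃[ y ] Dist x y e) × (∀ y d → Dist x y d → d ≤ e)

  degree : Fin n → ℕ
  degree x = length (filterᵇ (adj G x) (allFin n))

  MinDegreeAtLeast : ℕ → Set
  MinDegreeAtLeast δ = ∀ x → δ ≤ degree x

  IsCycle : (k : ℕ) → (Fin k → Fin n) → Set
  IsCycle k c = 3 ≤ k × Injective _≡_ _≡_ c ×
    (∀ (i j : Fin k) → suc (Data.Fin.toℕ i) ≡ Data.Fin.toℕ j → Adj (c i) (c j)) ×
    (∀ (i j : Fin k) → suc (Data.Fin.toℕ i) ≡ k → Data.Fin.toℕ j ≡ 0 → Adj (c i) (c j))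

  -- girth ≥ g: every cycle has length ≥ g (acyclic graphs have infinite girth)
  GirthAtLeast : ℕ → Set
  GirthAtLeast g = ∀ k (c : Fin k → Fin n) → IsCycle k c → g ≤ k

  Independent : Subset n → Set
  Independent S = ∀ x y → x ∈ S → y ∈ S → adj G x y ≡ false

  IndependenceNumber : ℕ → Set
  IndependenceNumber a =
    (∃[ S ] Independent S × ∣ S ∣ ≡ a) × (∀ S → Independent S → ∣ S ∣ ≤ a)

  IndependentBroadcast : (Fin n → ℕ) → Set
  IndependentBroadcast f =
    (∀ x e → Ecc x e → f x ≤ e) ×
    (∀ x y → x ≢ y → 0 < f x → 0 < f y → ∀ d → Dist x y d → f x ⊔ f y < d)

  weight : (Fin n → ℕ) → ℕ
  weight f = sum (map f (allFin n))

  BroadcastIndependenceNumber : ℕ → Set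
  BroadcastIndependenceNumber b =
    (∃[ f ] IndependentBroadcast f × weight f ≡ b) ×
    (∀ f → IndependentBroadcast f → weight f ≤ b)

module Submission where

-- Let f be a maximum independent broadcast and x₀ a vertex of maximum value.
-- Every broadcasting vertex x gets a radius r (⌊f x₀/2⌋ at x₀, ⌊(f x-1)/2⌋
-- elsewhere) and a geodesic v₀ = x, v₁, …, vᵣ, which exists as r ≤ f x ≤ ecc(x)
-- by condition B1.  The block of x consists of r+1 vertices: vₜ when t ≡ r (mod 2),
-- otherwise a neighbour wₜ of vₜ off the geodesic (minimum degree 3).  Girth ≥ 6
-- makes the vertices of one block pairwise distinct and non-adjacent, and
-- condition B2 does the same for two different blocks, because both lie within
-- their radii of broadcasting vertices at distance > max (f x) (f y).  The union T
-- of the blocks is independent, and f x ≤ 2·|block x|, strictly at x₀, so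
-- α_b(G) = weight f < 2·|T| ≤ 2·α(G).

open import Defs
open import Data.Nat using (ℕ; zero; suc; _+_; _*_; _∸_; _≤_; _<_; _⊔_; z≤n; s≤s; ⌊_/2⌋; _<?_; parity)
open import Data.Nat.Properties
open import Data.Parity using (Parity; 1ℙ; 0ℙ) renaming (_≟_ to _≟ₚ_)
open import Data.Parity.Properties using (p≢p⁻¹; suc-homo-⁻¹)
open import Data.Fin using (Fin; zero; suc; toℕ; fromℕ) renaming (_≟_ to _≟ᶠ_)
open import Data.Fin.Properties using (any?; toℕ-injective; toℕ-fromℕ)
open import Data.Fin.Subset using (Subset; _∈_; ∣_∣; ⁅_⁆; _∪_; _⊂_) renaming (⊥ to ∅)
open import Data.Fin.Subset.Properties using (∉⊥; x∈p∪q⁻; x∈p∪q⁺; q⊆p∪q; x∈⁅x⁆; x∈⁅y⁆⇒x≡y; p⊂q⇒∣p∣<∣q∣)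
open import Data.Bool using (true; false; T?)
open import Data.Bool.Properties using (T-≡) renaming (_≟_ to _≟ᵇ_)
open import Data.List using (List; []; _∷_; length; map; concatMap; foldr; allFin; applyUpTo)
open import Data.List.Properties using (length-++; length-applyUpTo)
open import Data.List.Membership.Propositional using () renaming (_∈_ to _∈ˡ_)
open import Data.List.Membership.Propositional.Properties using (∈-allFin; ∈-filter⁻)
open import Data.List.Relation.Unary.Any using (here; there)
open import Data.List.Relation.Unary.All as All using (All; []; _∷_)
open import Data.List.Relation.Unary.AllPairs as AllPairs using (AllPairs; []; _∷_)
import Data.List.Relation.Unary.All.Properties as AllP
import Data.List.Relation.Unary.AllPairs.Properties as AllPairsP
open import Data.List.Relation.Unary.Unique.Propositional using (Unique)
open import Data.List.Relation.Unary.Unique.Propositional.Properties using (filter⁺; allFin⁺)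
open import Data.List.Extrema.Nat using (argmax; f[xs]≤f[argmax])
open import Data.Nat.ListAction using (sum)
open import Data.Vec using (Vec; []; _∷_; lookup)
open import Data.Vec.Relation.Unary.Linked using (Linked; [-]; _∷_)
open import Data.Vec.Relation.Unary.All using ([]; _∷_)
open import Data.Vec.Relation.Unary.AllPairs using ([]; _∷_)
open import Data.Vec.Relation.Unary.Unique.Propositional using () renaming (Unique to Uniqueᵛ)
open import Data.Vec.Relation.Unary.Unique.Propositional.Properties using (lookup-injective)
open import Data.Product using (∃₂; ∃-syntax; _×_; _,_; proj₁; proj₂)
open import Data.Sum using (_⊎_; inj₁; inj₂)
open import Data.Empty using (⊥)
open import Function using (_∘_; Equivalence)
open import Relation.Nullary using (Dec; yes; no; ¬_; contradiction)
open import Relation.Binary.Definitions using (tri<; tri≈; tri>; Symmetric; DecidableEquality)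
open import Relation.Binary.PropositionalEquality

module _ {P : ℕ → Set} (P? : ∀ k → Dec (P k)) where

  least-from : ∀ fuel m → (∀ k → k < m → ¬ P k) → P (m + fuel) →
               ∃[ d ] P d × (∀ k → P k → d ≤ k)
  least-from fuel m below p with P? m
  ... | yes pm = m , pm , λ k pk → ≮⇒≥ (λ k<m → below k k<m pk)
  least-from zero m below p | no ¬pm = contradiction (subst P (+-identityʳ m) p) ¬pm
  least-from (suc fuel) m below p | no ¬pm =
    least-from fuel (suc m) below′ (subst P (+-suc m fuel) p)
    where
    below′ : ∀ k → k < suc m → ¬ P k
    below′ k k<1+m with m≤n⇒m<n∨m≡n (≤-pred k<1+m)
    ... | inj₁ k<m = below k k<m
    ... | inj₂ refl = ¬pm

  least : ∀ {K} → P K → ∃[ d ] P d × (∀ k → P k → d ≤ k)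
  least {K} = least-from K 0 (λ _ ())

module _ {A B : Set} (f : A → ℕ) (blocks : A → List B)
         (bounded : ∀ x → f x ≤ 2 * length (blocks x)) where

  private
    size-∷ : ∀ x xs → 2 * length (concatMap blocks (x ∷ xs)) ≡
                      2 * length (blocks x) + 2 * length (concatMap blocks xs)
    size-∷ x xs = trans (cong (2 *_) (length-++ (blocks x)))
                        (*-distribˡ-+ 2 (length (blocks x)) (length (concatMap blocks xs)))

  charge≤ : ∀ xs → sum (map f xs) ≤ 2 * length (concatMap blocks xs)
  charge≤ [] = z≤n
  charge≤ (x ∷ xs) =
    subst (sum (map f (x ∷ xs)) ≤_) (sym (size-∷ x xs)) (+-mono-≤ (bounded x) (charge≤ xs))

  charge< : ∀ {x₀} xs → x₀ ∈ˡ xs → f x₀ < 2 * length (blocks x₀) →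
            sum (map f xs) < 2 * length (concatMap blocks xs)
  charge< (x ∷ xs) (here refl) strict =
    subst (sum (map f (x ∷ xs)) <_) (sym (size-∷ x xs)) (+-mono-<-≤ strict (charge≤ xs))
  charge< (x ∷ xs) (there x₀∈xs) strict =
    subst (sum (map f (x ∷ xs)) <_) (sym (size-∷ x xs))
      (+-mono-≤-< (bounded x) (charge< xs x₀∈xs strict))

maximiser : ∀ {n} (g : Fin n → ℕ) → Fin n → ∃[ y ] ∀ z → g z ≤ g y
maximiser {n} g default = argmax g default (allFin n) ,
  λ z → All.lookup (f[xs]≤f[argmax] default (allFin n)) (∈-allFin z)

Linked-lookup : ∀ {A : Set} {R : A → A → Set} {k} {xs : Vec A k} → Linked R xs →
                ∀ i j → suc (toℕ i) ≡ toℕ j → R (lookup xs i) (lookup xs j)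
Linked-lookup {xs = _ ∷ _ ∷ _} (r ∷ _) zero (suc zero) refl = r
Linked-lookup (_ ∷ rs) (suc i) (suc j) next = Linked-lookup rs i j (suc-injective next)

fromList : ∀ {n} → List (Fin n) → Subset n
fromList = foldr (λ x p → ⁅ x ⁆ ∪ p) ∅

fromList-sound : ∀ {n} (xs : List (Fin n)) {q} → q ∈ fromList xs → q ∈ˡ xs
fromList-sound [] q∈ = contradiction q∈ ∉⊥
fromList-sound (x ∷ xs) q∈ with x∈p∪q⁻ ⁅ x ⁆ (fromList xs) q∈
... | inj₁ q∈⁅x⁆ = here (x∈⁅y⁆⇒x≡y x q∈⁅x⁆)
... | inj₂ q∈rest = there (fromList-sound xs q∈rest)

fromList-size : ∀ {n} (xs : List (Fin n)) → Unique xs → length xs ≤ ∣ fromList xs ∣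
fromList-size [] _ = z≤n
fromList-size (x ∷ xs) (x∉xs ∷ unique) =
  ≤-trans (s≤s (fromList-size xs unique)) (p⊂q⇒∣p∣<∣q∣ grows)
  where
  grows : fromList xs ⊂ ⁅ x ⁆ ∪ fromList xs
  grows = q⊆p∪q ⁅ x ⁆ (fromList xs) , x , x∈p∪q⁺ (inj₁ (x∈⁅x⁆ x)) ,
          λ x∈xs → All.lookup x∉xs (fromList-sound xs x∈xs) refl

AllPairs-entries : ∀ {A : Set} {R : A → A → Set} → Symmetric R → ∀ {xs} →
                   AllPairs R xs → ∀ {a b} → a ∈ˡ xs → b ∈ˡ xs → a ≡ b ⊎ R a b
AllPairs-entries R-sym (_ ∷ _) (here refl) (here refl) = inj₁ refl
AllPairs-entries R-sym (Ra ∷ _) (here refl) (there b∈) = inj₂ (All.lookup Ra b∈)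
AllPairs-entries R-sym (Ra ∷ _) (there a∈) (here refl) = inj₂ (R-sym (All.lookup Ra a∈))
AllPairs-entries R-sym (_ ∷ Rs) (there a∈) (there b∈) = AllPairs-entries R-sym Rs a∈ b∈

module _ {A : Set} (_≟_ : DecidableEquality A) where

  avoid-one : ∀ {ys : List A} → Unique ys → 2 ≤ length ys → ∀ q → ∃[ w ] w ∈ˡ ys × w ≢ q
  avoid-one {_ ∷ []} _ (s≤s ()) _
  avoid-one {a ∷ b ∷ _} ((a≢b ∷ _) ∷ _) _ q with a ≟ q
  ... | no a≢q = a , here refl , a≢q
  ... | yes refl = b , there (here refl) , ≢-sym a≢b

  avoid-two : ∀ {ys : List A} → Unique ys → 3 ≤ length ys → ∀ p q →
              ∃[ w ] w ∈ˡ ys × w ≢ p × w ≢ q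
  avoid-two {a ∷ _} (a∉rest ∷ unique) (s≤s len) p q with a ≟ p | a ≟ q
  ... | no a≢p | no a≢q = a , here refl , a≢p , a≢q
  ... | yes refl | _ with avoid-one unique len q
  ...   | w , w∈ , w≢q = w , there w∈ , ≢-sym (All.lookup a∉rest w∈) , w≢q
  avoid-two {a ∷ _} (a∉rest ∷ unique) (s≤s len) p q | no _ | yes refl
    with avoid-one unique len p
  ...   | w , w∈ , w≢p = w , there w∈ , w≢p , ≢-sym (All.lookup a∉rest w∈)

parity-suc≢ : ∀ t → parity (suc t) ≢ parity t
parity-suc≢ t e = p≢p⁻¹ (parity (suc t)) (trans e (sym (suc-homo-⁻¹ t)))

parity-two-valued : ∀ {p q r : Parity} → p ≢ r → q ≢ r → p ≡ q
parity-two-valued {1ℙ} {1ℙ} _ _ = refl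
parity-two-valued {0ℙ} {0ℙ} _ _ = refl
parity-two-valued {1ℙ} {0ℙ} {1ℙ} p≢r _ = contradiction refl p≢r
parity-two-valued {1ℙ} {0ℙ} {0ℙ} _ q≢r = contradiction refl q≢r
parity-two-valued {0ℙ} {1ℙ} {1ℙ} _ q≢r = contradiction refl q≢r
parity-two-valued {0ℙ} {1ℙ} {0ℙ} p≢r _ = contradiction refl p≢r

same-parity-gap : ∀ {t t′} → t < t′ → parity t ≡ parity t′ → 2 + t ≤ t′
same-parity-gap {t} t<t′ same with m≤n⇒m<n∨m≡n t<t′
... | inj₁ gap = gap
... | inj₂ refl = contradiction (sym same) (parity-suc≢ t)

same-parity-two : ∀ {t t′} → t < t′ → parity t ≡ parity t′ → t′ ≤ 3 + t → t′ ≡ 2 + t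
same-parity-two {t} t<t′ same t′≤ with m≤n⇒m<n∨m≡n (same-parity-gap t<t′ same)
... | inj₂ two = sym two
... | inj₁ three = contradiction (sym (trans same (cong parity (≤-antisym t′≤ three))))
                                 (parity-suc≢ t)

opposite-parity-step : ∀ {t t′} → t < t′ → t′ ≤ 2 + t → parity t ≢ parity t′ → t′ ≡ suc t
opposite-parity-step {t} t<t′ t′≤ opposite with m≤n⇒m<n∨m≡n t<t′
... | inj₂ one = sym one
... | inj₁ two = contradiction (cong parity (sym (≤-antisym t′≤ two))) opposite

opposite-parity-near : ∀ {t t′} → parity t ≢ parity t′ → t ≤ 2 + t′ → t′ ≤ 2 + t →
                       t′ ≡ suc t ⊎ t ≡ suc t′
opposite-parity-near {t} {t′} opposite t≤ t′≤ with <-cmp t t′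
... | tri< t<t′ _ _ = inj₁ (opposite-parity-step t<t′ t′≤ opposite)
... | tri≈ _ refl _ = contradiction refl opposite
... | tri> _ _ t′<t = inj₂ (opposite-parity-step t′<t t≤ (opposite ∘ sym))

-- Radii of the blocks.  The vertex of maximum broadcast value a gets
-- radius ⌊a/2⌋, every other broadcasting vertex radius ⌊(a-1)/2⌋.
centre-radius : ∀ a → 2 * ⌊ a /2⌋ ≤ a × a < 2 * suc ⌊ a /2⌋
centre-radius zero = z≤n , s≤s z≤n
centre-radius (suc zero) = z≤n , s≤s (s≤s z≤n)
centre-radius (suc (suc a)) with centre-radius a
... | lower , upper =
  subst (_≤ 2 + a) (sym (*-suc 2 ⌊ a /2⌋)) (s≤s (s≤s lower)) ,
  subst (2 + a <_) (sym (*-suc 2 (suc ⌊ a /2⌋))) (s≤s (s≤s upper))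

other-radius : ∀ a → 0 < a → 2 * ⌊ (a ∸ 1) /2⌋ < a × a ≤ 2 * suc ⌊ (a ∸ 1) /2⌋
other-radius (suc a) _ with centre-radius a
... | lower , upper = s≤s lower , upper

-- Two blocks fit between broadcasting vertices when their radii are small.
radii-fit : ∀ {rx ry a b} → 2 * rx + 2 * ry < a + b → rx + suc ry ≤ a ⊔ b
radii-fit {rx} {ry} {a} {b} small =
  subst (_≤ a ⊔ b) (sym (+-suc rx ry)) (*-cancelˡ-< 2 (rx + ry) (a ⊔ b) doubled)
  where
  open ≤-Reasoning
  doubled : 2 * (rx + ry) < 2 * (a ⊔ b)
  doubled = begin-strict
    2 * (rx + ry)     ≡⟨ *-distribˡ-+ 2 rx ry ⟩
    2 * rx + 2 * ry   <⟨ small ⟩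
    a + b             ≤⟨ +-mono-≤ (m≤m⊔n a b) (m≤n⊔m a b) ⟩
    (a ⊔ b) + (a ⊔ b) ≡⟨ cong ((a ⊔ b) +_) (sym (+-identityʳ (a ⊔ b))) ⟩
    2 * (a ⊔ b)       ∎

module Walks {n : ℕ} (G : Graph n) where

  Adj-sym : ∀ {x y} → Adj G x y → Adj G y x
  Adj-sym {x} {y} xy = trans (adj-sym G y x) xy

  Adj⇒≢ : ∀ {x y} → Adj G x y → x ≢ y
  Adj⇒≢ {x} xy refl with trans (sym xy) (adj-irr G x)
  ... | ()

  ¬Adj⇒adj≡false : ∀ {x y} → ¬ Adj G x y → adj G x y ≡ false
  ¬Adj⇒adj≡false {x} {y} ¬xy with adj G x y
  ... | true = contradiction refl ¬xy
  ... | false = refl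

  Apart : Fin n → Fin n → Set
  Apart a b = a ≢ b × ¬ Adj G a b

  Apart-sym : ∀ {a b} → Apart a b → Apart b a
  Apart-sym (a≢b , ¬ab) = ≢-sym a≢b , ¬ab ∘ Adj-sym

  _++ʷ_ : ∀ {x y z j k} → Walk G x y j → Walk G y z k → Walk G x z (j + k)
  here ++ʷ v = v
  step a w ++ʷ v = step a (w ++ʷ v)

  infixl 5 _▷_
  _▷_ : ∀ {x y z k} → Walk G x y k → Adj G y z → Walk G x z (suc k)
  here ▷ yz = step yz here
  step a w ▷ yz = step a (w ▷ yz)

  reverse : ∀ {x y k} → Walk G x y k → Walk G y x k
  reverse here = here
  reverse (step a w) = reverse w ▷ Adj-sym a

  walk? : ∀ k x y → Dec (Walk G x y k)
  walk? zero x y with x ≟ᶠ y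
  ... | yes refl = yes here
  ... | no x≢y = no λ { here → x≢y refl }
  walk? (suc k) x y with any? first-step
    where
    first-step : ∀ z → Dec (Adj G x z × Walk G z y k)
    first-step z with adj G x z ≟ᵇ true | walk? k z y
    ... | yes xz | yes w = yes (xz , w)
    ... | no ¬xz | _ = no (¬xz ∘ proj₁)
    ... | _ | no ¬w = no (¬w ∘ proj₂)
  ... | yes (z , xz , w) = yes (step xz w)
  ... | no none = no λ { (step xz w) → none (_ , xz , w) }

  Dist-unique : ∀ {x y d d′} → Dist G x y d → Dist G x y d′ → d ≡ d′
  Dist-unique (w , shortest) (w′ , shortest′) = ≤-antisym (shortest _ w′) (shortest′ _ w)

  vertexAt : ∀ {x y k} → Walk G x y k → ℕ → Fin n
  vertexAt {x} w zero = x
  vertexAt {x} here (suc i) = x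
  vertexAt (step _ w) (suc i) = vertexAt w i

  prefix : ∀ {x y k} (w : Walk G x y k) {i} → i ≤ k → Walk G x (vertexAt w i) i
  prefix w z≤n = here
  prefix (step a w) (s≤s i≤k) = step a (prefix w i≤k)

  suffix : ∀ {x y k} (w : Walk G x y k) {i} → i ≤ k → Walk G (vertexAt w i) y (k ∸ i)
  suffix w z≤n = w
  suffix (step a w) (s≤s i≤k) = suffix w i≤k

  vertexAt-adj : ∀ {x y k} (w : Walk G x y k) {i} → i < k →
                 Adj G (vertexAt w i) (vertexAt w (suc i))
  vertexAt-adj (step a w) (s≤s z≤n) = a
  vertexAt-adj (step a w) (s≤s (s≤s i<k)) = vertexAt-adj w (s≤s i<k)

  prefix-shortest : ∀ {x y e} → (d : Dist G x y e) → ∀ {i} → (i≤e : i ≤ e) →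
                    Dist G x (vertexAt (proj₁ d) i) i
  prefix-shortest {e = e} (w , shortest) {i} i≤e = prefix w i≤e , λ j w′ →
    +-cancelʳ-≤ (e ∸ i) i j
      (subst (_≤ j + (e ∸ i)) (sym (m+[n∸m]≡n i≤e)) (shortest _ (w′ ++ʷ suffix w i≤e)))

  record Geodesic (x : Fin n) (s : ℕ) : Set where
    field
      vertex : ℕ → Fin n
      vertex-dist : ∀ {i} → i ≤ s → Dist G x (vertex i) i
      vertex-adj : ∀ {i} → i < s → Adj G (vertex i) (vertex (suc i))

  geodesic : ∀ {x y e s} → Dist G x y e → s ≤ e → Geodesic x s
  geodesic d s≤e = record
    { vertex = vertexAt (proj₁ d)
    ; vertex-dist = λ i≤s → prefix-shortest d (≤-trans i≤s s≤e)
    ; vertex-adj = λ i<s → vertexAt-adj (proj₁ d) (<-≤-trans i<s s≤e)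
    }

  third-neighbour : ∀ {x} → 3 ≤ degree G x → ∀ p q → ∃[ w ] Adj G x w × w ≢ p × w ≢ q
  third-neighbour {x} deg p q
    with avoid-two _≟ᶠ_ (filter⁺ (λ w → T? (adj G x w)) (allFin⁺ n)) deg p q
  ... | w , w∈ , w≢p , w≢q =
    w , Equivalence.to T-≡ (proj₂ (∈-filter⁻ (λ w → T? (adj G x w)) {xs = allFin n} w∈)) ,
    w≢p , w≢q

  module Distances (connected : Connected G) where

    dist-exists : ∀ x y → ∃[ d ] Dist G x y d
    dist-exists x y = least (λ k → walk? k x y) (proj₂ (connected x y))

    distance : Fin n → Fin n → ℕ
    distance x y = proj₁ (dist-exists x y)

    eccentric-vertex : ∀ x → ∃₂ λ y e → Dist G x y e × Ecc G x e
    eccentric-vertex x with maximiser (distance x) x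
    ... | y , y-max = y , distance x y , dist-y , (y , dist-y) , farthest
      where
      dist-y : Dist G x y (distance x y)
      dist-y = proj₂ (dist-exists x y)
      farthest : ∀ z d → Dist G x z d → d ≤ distance x y
      farthest z d dist-z =
        subst (_≤ distance x y) (Dist-unique (proj₂ (dist-exists x z)) dist-z) (y-max z)

    broadcast-geodesic : ∀ {f} → IndependentBroadcast G f → ∀ x {s} → s ≤ f x → Geodesic x s
    broadcast-geodesic (within-ecc , _) x s≤fx with eccentric-vertex x
    ... | _ , e , dist-y , ecc = geodesic dist-y (≤-trans s≤fx (within-ecc x e ecc))

  module ShortCycles (girth : GirthAtLeast G 6) where

    no-short-cycle : ∀ {m} (cs : Vec (Fin n) (3 + m)) → m < 3 → Uniqueᵛ cs →
                     Linked (Adj G) cs → Adj G (lookup cs (fromℕ (2 + m))) (lookup cs zero) → ⊥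
    no-short-cycle {m} cs m<3 unique linked closing =
      <⇒≱ m<3 (+-cancelˡ-≤ 3 3 m (girth (3 + m) (lookup cs) is-cycle))
      where
      closes : ∀ i j → suc (toℕ i) ≡ 3 + m → toℕ j ≡ 0 → Adj G (lookup cs i) (lookup cs j)
      closes i j i-last j-first = subst₂ (λ i j → Adj G (lookup cs i) (lookup cs j))
        (toℕ-injective (trans (toℕ-fromℕ (2 + m)) (sym (suc-injective i-last))))
        (sym (toℕ-injective {j = zero} j-first)) closing
      is-cycle : IsCycle G (3 + m) (lookup cs)
      is-cycle = s≤s (s≤s (s≤s z≤n)) , (λ {i} {j} → lookup-injective unique i j) ,
                 Linked-lookup linked , closes

    no-triangle : ∀ {a b c} → Adj G a b → Adj G b c → Adj G c a → ⊥
    no-triangle ab bc ca = no-short-cycle (_ ∷ _ ∷ _ ∷ []) (s≤s z≤n)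
      ((Adj⇒≢ ab ∷ ≢-sym (Adj⇒≢ ca) ∷ []) ∷ (Adj⇒≢ bc ∷ []) ∷ [] ∷ [])
      (ab ∷ bc ∷ [-]) ca

    no-square : ∀ {a b c d} → Adj G a b → Adj G b c → Adj G c d → Adj G d a →
                a ≢ c → b ≢ d → ⊥
    no-square ab bc cd da a≢c b≢d = no-short-cycle (_ ∷ _ ∷ _ ∷ _ ∷ []) (s≤s (s≤s z≤n))
      ((Adj⇒≢ ab ∷ a≢c ∷ ≢-sym (Adj⇒≢ da) ∷ []) ∷ (Adj⇒≢ bc ∷ b≢d ∷ []) ∷
       (Adj⇒≢ cd ∷ []) ∷ [] ∷ [])
      (ab ∷ bc ∷ cd ∷ [-]) da

    -- a closed 5-walk is a 5-cycle unless two of its vertices coincide,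
    -- in which case it contains a triangle
    no-closed-5-walk : ∀ {a b c d e} → Adj G a b → Adj G b c → Adj G c d →
                       Adj G d e → Adj G e a → ⊥
    no-closed-5-walk {a} {b} {c} {d} {e} ab bc cd de ea
      with a ≟ᶠ c | a ≟ᶠ d | b ≟ᶠ d | b ≟ᶠ e | c ≟ᶠ e
    ... | yes refl | _ | _ | _ | _ = no-triangle cd de ea
    ... | _ | yes refl | _ | _ | _ = no-triangle ab bc cd
    ... | _ | _ | yes refl | _ | _ = no-triangle ab de ea
    ... | _ | _ | _ | yes refl | _ = no-triangle bc cd de
    ... | _ | _ | _ | _ | yes refl = no-triangle ab bc ea
    ... | no a≢c | no a≢d | no b≢d | no b≢e | no c≢e =
      no-short-cycle (a ∷ b ∷ c ∷ d ∷ e ∷ []) (s≤s (s≤s (s≤s z≤n)))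
        ((Adj⇒≢ ab ∷ a≢c ∷ a≢d ∷ ≢-sym (Adj⇒≢ ea) ∷ []) ∷
         (Adj⇒≢ bc ∷ b≢d ∷ b≢e ∷ []) ∷ (Adj⇒≢ cd ∷ c≢e ∷ []) ∷ (Adj⇒≢ de ∷ []) ∷ [] ∷ [])
        (ab ∷ bc ∷ cd ∷ de ∷ [-]) ea

-- Around a geodesic v₀ = x, v₁, …, vₛ we choose s+1 pairwise apart vertices
-- u₀, …, uₛ within distance s of x: uₜ = vₜ when t ≡ s (mod 2), and otherwise
-- a neighbour wₜ of vₜ off the geodesic.  Girth ≥ 6 keeps them apart.
module Block {n : ℕ} (G : Graph n) (girth : GirthAtLeast G 6)
             (min-degree : MinDegreeAtLeast G 3)
             {x : Fin n} {s : ℕ} (geo : Walks.Geodesic G x s) where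
  open Walks G
  open ShortCycles girth
  open Geodesic geo renaming (vertex to v)

  reach : ∀ {i} → i ≤ s → Walk G x (v i) i
  reach i≤s = proj₁ (vertex-dist i≤s)

  shortest : ∀ {i j} → i ≤ s → Walk G x (v i) j → i ≤ j
  shortest i≤s w = proj₂ (vertex-dist i≤s) _ w

  -- the neighbour of vᵢ preceding it on the geodesic (v₁ stands in for i = 0)
  predecessor : ℕ → Fin n
  predecessor zero = v 1
  predecessor (suc i) = v i

  off-neighbour : ∀ i → ∃[ w ] Adj G (v i) w × w ≢ predecessor i × w ≢ v (suc i)
  off-neighbour i = third-neighbour (min-degree (v i)) (predecessor i) (v (suc i))

  w : ℕ → Fin n
  w i = proj₁ (off-neighbour i)

  w-adj : ∀ i → Adj G (v i) (w i)
  w-adj i = proj₁ (proj₂ (off-neighbour i))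

  w≢pred : ∀ i → w (suc i) ≢ v i
  w≢pred i = proj₁ (proj₂ (proj₂ (off-neighbour (suc i))))

  w≢succ : ∀ i → w i ≢ v (suc i)
  w≢succ i = proj₂ (proj₂ (proj₂ (off-neighbour i)))

  v-distinct : ∀ {i j} → i < j → j ≤ s → v i ≢ v j
  v-distinct {i} i<j j≤s vi≡vj =
    <⇒≱ i<j (shortest j≤s (subst (λ z → Walk G x z i) vi≡vj (reach (≤-trans (<⇒≤ i<j) j≤s))))

  v-nonadjacent : ∀ {i j} → 2 + i ≤ j → j ≤ s → ¬ Adj G (v i) (v j)
  v-nonadjacent gap j≤s vivj =
    <⇒≱ gap (shortest j≤s (reach (≤-trans (≤-trans (n≤1+n _) (<⇒≤ gap)) j≤s) ▷ vivj))

  v-w-apart : ∀ {i j} → i ≤ s → j < s → parity i ≢ parity j → Apart (v i) (w j)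
  v-w-apart {i} {j} i≤s j<s opposite = distinct , nonadjacent
    where
    distinct : v i ≢ w j
    distinct vi≡wj with opposite-parity-near opposite
      (m≤n⇒m≤1+n (shortest i≤s (reach (<⇒≤ j<s) ▷ vjvi)))
      (m≤n⇒m≤1+n (shortest (<⇒≤ j<s) (reach i≤s ▷ Adj-sym vjvi)))
      where
      vjvi : Adj G (v j) (v i)
      vjvi = subst (Adj G (v j)) (sym vi≡wj) (w-adj j)
    ... | inj₁ refl = w≢pred i (sym vi≡wj)
    ... | inj₂ refl = w≢succ j (sym vi≡wj)
    nonadjacent : ¬ Adj G (v i) (w j)
    nonadjacent viwj with opposite-parity-near opposite
      (shortest i≤s (reach (<⇒≤ j<s) ▷ w-adj j ▷ Adj-sym viwj))
      (shortest (<⇒≤ j<s) (reach i≤s ▷ viwj ▷ Adj-sym (w-adj j)))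
    ... | inj₁ refl = no-triangle viwj (Adj-sym (w-adj (suc i))) (Adj-sym (vertex-adj (<⇒≤ j<s)))
    ... | inj₂ refl = no-triangle (w-adj j) (Adj-sym viwj) (Adj-sym (vertex-adj i≤s))

  w-w-apart : ∀ {i j} → i < j → j < s → parity i ≡ parity j → Apart (w i) (w j)
  w-w-apart {i} {j} i<j j<s same = distinct , nonadjacent
    where
    j≤s : j ≤ s
    j≤s = <⇒≤ j<s
    i≤s : i ≤ s
    i≤s = <⇒≤ (<-trans i<j j<s)
    wi~vj : w i ≡ w j → Adj G (w i) (v j)
    wi~vj wi≡wj = Adj-sym (subst (Adj G (v j)) (sym wi≡wj) (w-adj j))
    distinct : w i ≢ w j
    distinct wi≡wj with same-parity-two i<j same
      (m≤n⇒m≤1+n (shortest j≤s (reach i≤s ▷ w-adj i ▷ wi~vj wi≡wj)))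
    ... | refl = no-square (w-adj i) (wi~vj wi≡wj) (Adj-sym (vertex-adj j≤s))
                   (Adj-sym (vertex-adj (<-trans (n<1+n _) j≤s)))
                   (v-distinct (s≤s (n≤1+n i)) j≤s) (w≢succ i)
    nonadjacent : ¬ Adj G (w i) (w j)
    nonadjacent wiwj with same-parity-two i<j same
      (shortest j≤s (reach i≤s ▷ w-adj i ▷ wiwj ▷ Adj-sym (w-adj j)))
    ... | refl = no-closed-5-walk (w-adj i) wiwj (Adj-sym (w-adj j)) (Adj-sym (vertex-adj j≤s))
                   (Adj-sym (vertex-adj (<-trans (n<1+n _) j≤s)))

  data Chosen (t : ℕ) : Fin n → Set where
    on-geodesic  : parity t ≡ parity s → Chosen t (v t)
    off-geodesic : parity t ≢ parity s → Chosen t (w t)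

  u : ℕ → Fin n
  u t with parity t ≟ₚ parity s
  ... | yes _ = v t
  ... | no _ = w t

  chosen : ∀ t → Chosen t (u t)
  chosen t with parity t ≟ₚ parity s
  ... | yes same = on-geodesic same
  ... | no opposite = off-geodesic opposite

  below-top : ∀ {t} → t ≤ s → parity t ≢ parity s → t < s
  below-top t≤s opposite with m≤n⇒m<n∨m≡n t≤s
  ... | inj₁ t<s = t<s
  ... | inj₂ refl = contradiction refl opposite

  u-apart : ∀ {t t′} → t < t′ → t′ ≤ s → Apart (u t) (u t′)
  u-apart {t} {t′} t<t′ t′≤s = apart (chosen t) (chosen t′)
    where
    t≤s : t ≤ s
    t≤s = ≤-trans (<⇒≤ t<t′) t′≤s
    apart : ∀ {a b} → Chosen t a → Chosen t′ b → Apart a b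
    apart (on-geodesic p) (on-geodesic p′) =
      v-distinct t<t′ t′≤s , v-nonadjacent (same-parity-gap t<t′ (trans p (sym p′))) t′≤s
    apart (off-geodesic p) (off-geodesic p′) =
      w-w-apart t<t′ (below-top t′≤s p′) (parity-two-valued p p′)
    apart (on-geodesic p) (off-geodesic p′) =
      v-w-apart t≤s (below-top t′≤s p′) (λ e → p′ (trans (sym e) p))
    apart (off-geodesic p) (on-geodesic p′) =
      Apart-sym (v-w-apart t′≤s (below-top t≤s p) (λ e → p (trans (sym e) p′)))

  u-near : ∀ {t} → t ≤ s → ∃[ j ] j ≤ s × Walk G x (u t) j
  u-near {t} t≤s = near (chosen t)
    where
    near : ∀ {a} → Chosen t a → ∃[ j ] j ≤ s × Walk G x a j
    near (on-geodesic _) = t , t≤s , reach t≤s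
    near (off-geodesic opposite) = suc t , below-top t≤s opposite , reach t≤s ▷ w-adj t

module Packing {n : ℕ} (G : Graph n) (connected : Connected G)
               (girth : GirthAtLeast G 6) (min-degree : MinDegreeAtLeast G 3)
               {f : Fin n → ℕ} (broadcast : IndependentBroadcast G f)
               (x₀ : Fin n) (x₀-max : ∀ z → f z ≤ f x₀) where
  open Walks G
  open Distances connected

  module BlockAt (x : Fin n) {r : ℕ} (r≤fx : r ≤ f x) =
    Block G girth min-degree (broadcast-geodesic broadcast x r≤fx)

  block : ∀ x {r} → r ≤ f x → List (Fin n)
  block x {r} r≤fx = applyUpTo (BlockAt.u x r≤fx) (suc r)

  block-length : ∀ x {r} (r≤fx : r ≤ f x) → length (block x r≤fx) ≡ suc r
  block-length x {r} r≤fx = length-applyUpTo (BlockAt.u x r≤fx) (suc r)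

  block-apart : ∀ x {r} (r≤fx : r ≤ f x) → AllPairs Apart (block x r≤fx)
  block-apart x {r} r≤fx = AllPairsP.applyUpTo⁺₁ (BlockAt.u x r≤fx) (suc r)
    λ t<t′ t′<1+r → BlockAt.u-apart x r≤fx t<t′ (≤-pred t′<1+r)

  -- vertices within distance i of x and j of y are apart when
  -- i + j + 1 ≤ max (f x) (f y), since this is below dist(x, y) by (B2)
  apart-by-distance : ∀ {x y p q i j} → x ≢ y → 0 < f x → 0 < f y →
                      Walk G x p i → Walk G y q j → i + suc j ≤ f x ⊔ f y → Apart p q
  apart-by-distance {x} {y} {p} {q} {i} {j} x≢y fx>0 fy>0 wp wq close = distinct , nonadjacent
    where
    far : f x ⊔ f y < distance x y
    far = proj₂ broadcast x y x≢y fx>0 fy>0 _ (proj₂ (dist-exists x y))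
    shortest : ∀ k → Walk G x y k → distance x y ≤ k
    shortest = proj₂ (proj₂ (dist-exists x y))
    distinct : p ≢ q
    distinct refl = <⇒≱ far
      (≤-trans (shortest _ (wp ++ʷ reverse wq)) (≤-trans (+-monoʳ-≤ i (n≤1+n j)) close))
    nonadjacent : ¬ Adj G p q
    nonadjacent pq = <⇒≱ far (≤-trans (shortest _ (wp ++ʷ step pq (reverse wq))) close)

  blocks-apart : ∀ {x y rx ry} → x ≢ y → 0 < f x → 0 < f y →
                 (rx≤ : rx ≤ f x) (ry≤ : ry ≤ f y) → 2 * rx + 2 * ry < f x + f y →
                 All (λ p → All (Apart p) (block y ry≤)) (block x rx≤)
  blocks-apart {x} {y} {rx} {ry} x≢y fx>0 fy>0 rx≤ ry≤ small =
    AllP.applyUpTo⁺₁ _ (suc rx) λ t<1+rx → AllP.applyUpTo⁺₁ _ (suc ry) λ t′<1+ry →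
      apart (BlockAt.u-near x rx≤ (≤-pred t<1+rx)) (BlockAt.u-near y ry≤ (≤-pred t′<1+ry))
    where
    apart : ∀ {p q} → ∃[ i ] i ≤ rx × Walk G x p i → ∃[ j ] j ≤ ry × Walk G y q j → Apart p q
    apart (i , i≤rx , wp) (j , j≤ry , wq) = apart-by-distance x≢y fx>0 fy>0 wp wq
      (≤-trans (+-mono-≤ i≤rx (s≤s j≤ry)) (radii-fit {a = f x} {f y} small))

  data Role (x : Fin n) : Set where
    centre      : x ≡ x₀ → Role x
    broadcaster : x ≢ x₀ → 0 < f x → Role x
    silent      : x ≢ x₀ → f x ≡ 0 → Role x

  role : ∀ x → Role x
  role x with x ≟ᶠ x₀ | 0 <? f x
  ... | yes x≡x₀ | _ = centre x≡x₀
  ... | no x≢x₀ | yes fx>0 = broadcaster x≢x₀ fx>0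
  ... | no x≢x₀ | no fx≯0 = silent x≢x₀ (n≤0⇒n≡0 (≮⇒≥ fx≯0))

  -- both radii are at most f x, so the required geodesics exist
  centre-r≤ : ∀ x → ⌊ f x /2⌋ ≤ f x
  centre-r≤ x = ⌊n/2⌋≤n (f x)

  other-r≤ : ∀ x → ⌊ (f x ∸ 1) /2⌋ ≤ f x
  other-r≤ x = ≤-trans (⌊n/2⌋≤n (f x ∸ 1)) (m∸n≤m (f x) 1)

  blockOf : ∀ {x} → Role x → List (Fin n)
  blockOf {x} (centre _) = block x (centre-r≤ x)
  blockOf {x} (broadcaster _ _) = block x (other-r≤ x)
  blockOf (silent _ _) = []

  blockOf-apart : ∀ {x} (ρ : Role x) → AllPairs Apart (blockOf ρ)
  blockOf-apart {x} (centre _) = block-apart x (centre-r≤ x)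
  blockOf-apart {x} (broadcaster _ _) = block-apart x (other-r≤ x)
  blockOf-apart (silent _ _) = []

  -- the radii chosen by role are small enough; x₀ broadcasts if anyone does
  roles-apart : ∀ {x y} → x ≢ y → (ρ : Role x) (σ : Role y) →
                All (λ p → All (Apart p) (blockOf σ)) (blockOf ρ)
  roles-apart x≢y (silent _ _) σ = []
  roles-apart x≢y ρ (silent _ _) = All.universal (λ _ → []) (blockOf ρ)
  roles-apart x≢y (centre refl) (centre refl) = contradiction refl x≢y
  roles-apart {y = y} x≢y (centre refl) (broadcaster _ fy>0) =
    blocks-apart x≢y (<-≤-trans fy>0 (x₀-max y)) fy>0 (centre-r≤ x₀) (other-r≤ y)
      (+-mono-≤-< (proj₁ (centre-radius (f x₀))) (proj₁ (other-radius (f y) fy>0)))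
  roles-apart {x} x≢y (broadcaster _ fx>0) (centre refl) =
    blocks-apart x≢y fx>0 (<-≤-trans fx>0 (x₀-max x)) (other-r≤ x) (centre-r≤ x₀)
      (+-mono-<-≤ (proj₁ (other-radius (f x) fx>0)) (proj₁ (centre-radius (f x₀))))
  roles-apart {x} {y} x≢y (broadcaster _ fx>0) (broadcaster _ fy>0) =
    blocks-apart x≢y fx>0 fy>0 (other-r≤ x) (other-r≤ y)
      (+-mono-<-≤ (proj₁ (other-radius (f x) fx>0)) (<⇒≤ (proj₁ (other-radius (f y) fy>0))))

  blockOf-pays : ∀ {x} (ρ : Role x) → f x ≤ 2 * length (blockOf ρ)
  blockOf-pays {x} (centre _) = subst (λ k → f x ≤ 2 * k) (sym (block-length x (centre-r≤ x)))
    (<⇒≤ (proj₂ (centre-radius (f x))))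
  blockOf-pays {x} (broadcaster _ fx>0) = subst (λ k → f x ≤ 2 * k)
    (sym (block-length x (other-r≤ x))) (proj₂ (other-radius (f x) fx>0))
  blockOf-pays (silent _ fx≡0) = ≤-reflexive fx≡0

  centre-pays : (ρ : Role x₀) → f x₀ < 2 * length (blockOf ρ)
  centre-pays (centre _) = subst (λ k → f x₀ < 2 * k) (sym (block-length x₀ (centre-r≤ x₀)))
    (proj₂ (centre-radius (f x₀)))
  centre-pays (broadcaster x₀≢x₀ _) = contradiction refl x₀≢x₀
  centre-pays (silent x₀≢x₀ _) = contradiction refl x₀≢x₀

  blocks : Fin n → List (Fin n)
  blocks = blockOf ∘ role

  packed : List (Fin n)
  packed = concatMap blocks (allFin n)

  packed-apart : AllPairs Apart packed
  packed-apart = AllPairsP.concat⁺ (AllP.map⁺ (AllP.tabulate⁺ (blockOf-apart ∘ role)))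
    (AllPairsP.map⁺ (AllPairs.map (λ {x} {y} x≢y → roles-apart x≢y (role x) (role y)) (allFin⁺ n)))

  T : Subset n
  T = fromList packed

  T-independent : Independent G T
  T-independent p q p∈T q∈T
    with AllPairs-entries Apart-sym packed-apart
           (fromList-sound packed p∈T) (fromList-sound packed q∈T)
  ... | inj₁ refl = adj-irr G p
  ... | inj₂ (_ , ¬pq) = ¬Adj⇒adj≡false ¬pq

  weight<2∣T∣ : weight G f < 2 * ∣ T ∣
  weight<2∣T∣ = begin-strict
    weight G f         <⟨ charge< f blocks (blockOf-pays ∘ role) (allFin n) (∈-allFin x₀)
                                  (centre-pays (role x₀)) ⟩
    2 * length packed  ≤⟨ *-monoʳ-≤ 2 (fromList-size packed (AllPairs.map proj₁ packed-apart)) ⟩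
    2 * ∣ T ∣          ∎
    where open ≤-Reasoning

theorem1 : ∀ {n} (G : Graph n) → 1 ≤ n → Connected G → GirthAtLeast G 6 →
    MinDegreeAtLeast G 3 → ∀ a b → IndependenceNumber G a →
    BroadcastIndependenceNumber G b → b < 2 * a
theorem1 {suc m} G _ connected girth min-degree a b (_ , α-max) ((f , broadcast , weight≡b) , _)
  with maximiser f zero
... | x₀ , x₀-max = begin-strict
  b           ≡⟨ sym weight≡b ⟩
  weight G f  <⟨ weight<2∣T∣ ⟩
  2 * ∣ T ∣   ≤⟨ *-monoʳ-≤ 2 (α-max T T-independent) ⟩
  2 * a       ∎
  where
  open Packing G connected girth min-degree broadcast x₀ x₀-max
  open ≤-Reasoning
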